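{- Let $G=(V,E_1,\dots,E_\alpha)$ be an $\alpha$-edge-colored graph and $k$ a positive integer such that: $G$ has no isolated vertex; no vertex has exactly one neighbor in any $G_j$; no vertex has total degree $2$ with exactly two neighbors; every edge has multiplicity at most $2$ in each $E_j$; $G$ has no self loops; and for no $j$ and no vertex $x$ is there an $x$-flower of order at least $k+1$ in $G_j$. Let $i\in\{1,\dots,\alpha\}$, let $v$ be a vertex of degree more than $3k(k+4)$ in $G_i$, and let $H_v\subseteq V\setminus\{v\}$ be a feedback vertex set of $G_i$ with $|H_v|\le 3k$. Let $V^i_0$ be the set of degree-$0$ vertices of $G_i$, let $G'_i=G_i\setminus(H_v\cup\{v\}\cup V^i_0)$, and let $\mathcal{D}$ be the set of connected components of $G'_i$ containing a vertex adjacent to $v$ in $G_i$. Let $\mathcal{B}$ be the bipartite graph with sides $H_v$ and $Q=\{q_D: D\in\mathcal{D}\}$, where $h\in H_v$ is adjacent to $q_D$ iff some vertex of $D$ is adjacent to $h$ in $G_i$. Let $H\subseteq H_v$ and $Q'\subseteq Q$ be nonempty sets such that $H$ has a $(k+2)$-expansion into $Q'$ in $\mathcal{B}$ and every neighbor in $\mathcal{B}$ of a vertex of $Q'$ lies in $H$. Let $G'$ be obtained from $G$ by deleting from $E_i$ all edges $(d,v)$ with $d\in V(D)$ for some $q_D\in Q'$, and then adding color-$i$ edges between $v$ and each $h\in H$ so that $v$ and $h$ are joined by a double edge in color $i$ (unless such a double edge already exists). Then $G$ has an $\alpha$-simfvs of size at most $k$ if and only if $G'$ has an $\alpha$-simfvs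 of size at most $k$.
   Context: An $\alpha$-edge-colored graph is a finite undirected multigraph with edge set partitioned into $\alpha$ color classes; $G_j=(V,E_j)$. Loops and double edges count as cycles. The total degree of a vertex is the sum of its degrees in all $G_j$. An $\alpha$-simfvs is a set $S\subseteq V$ such that $G_j\setminus S$ is a forest for every $j$. For a vertex $x$, an $x$-flower of order $m$ is a set of $m$ cycles whose pairwise intersection is exactly $\{x\}$. For a bipartite graph with sides $A,B$, $X\subseteq A$ and $Y\subseteq B$, a $q$-expansion of $X$ into $Y$ is a set $M$ of edges between $X$ and $Y$ such that every vertex of $X$ is incident with exactly $q$ edges of $M$ and $M$ saturates exactly $q|X|$ vertices of $Y$. -}

module Defs where

open import Data.Nat using (ℕ; zero; suc; _+_; _*_; _≤_; _<_; _≤?_)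
open import Data.Bool using (Bool; true; false; if_then_else_; _∧_; _∨_)
import Data.Bool.Properties as BoolP
open import Data.Fin using (Fin)
open import Data.Fin.Properties using (_≟_)
open import Data.Fin.Subset using (Subset; _∈_; _∉_; ∣_∣)
open import Data.Fin.Subset.Properties using (_∈?_)
open import Data.List using (List; []; _∷_; _++_; [_]; length; filter; map; allFin; deduplicate)
open import Data.List.Relation.Unary.All using (All)
open import Data.List.Relation.Unary.Any using (Any; any?)
open import Data.List.Relation.Unary.AllPairs using (AllPairs)
open import Data.List.Relation.Unary.Linked using (Linked)
open import Data.List.Relation.Unary.Unique.Propositional using (Unique)
import Data.List.Membership.Propositional as LMem
open import Data.Vec.Properties using (≡-dec)
open import Data.Nat.ListAction using (sum)
open import Data.Product using (Σ; ∃; _×_; _,_; proj₁; proj₂)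
open import Data.Empty using (⊥)
open import Relation.Nullary using (¬_; Dec; ¬?; does)
open import Relation.Nullary.Decidable using (_×-dec_)
open import Relation.Binary.PropositionalEquality using (_≡_; _≢_)
open import Relation.Binary.Construct.Closure.ReflexiveTransitive using (Star)

-- α-edge-colored finite multigraphs on the vertex set Fin n.
-- mult j x y = number of edges of color j between x and y
-- (mult j x x = number of loops of color j at x).
-- Undirectedness is imposed as a hypothesis (Symmetric) where needed.

ColGraph : ℕ → ℕ → Set
ColGraph α n = Fin α → Fin n → Fin n → ℕ

Mult : ℕ → Set
Mult n = Fin n → Fin n → ℕ

Symmetric : ∀ {α n} → ColGraph α n → Set
Symmetric {α} {n} G = ∀ (j : Fin α) (x y : Fin n) → G j x y ≡ G j y x

NoLoops : ∀ {α n} → ColGraph α n → Set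
NoLoops {α} {n} G = ∀ (j : Fin α) (x : Fin n) → G j x x ≡ 0

MultAtMost2 : ∀ {α n} → ColGraph α n → Set
MultAtMost2 {α} {n} G = ∀ (j : Fin α) (x y : Fin n) → G j x y ≤ 2

-- degree in a single color class; a loop contributes 2
deg : ∀ {n} → Mult n → Fin n → ℕ
deg {n} m x = sum (map (m x) (allFin n)) + m x x

totalDeg : ∀ {α n} → ColGraph α n → Fin n → ℕ
totalDeg {α} G x = sum (map (λ j → deg (G j) x) (allFin α))

neighbours : ∀ {n} → Mult n → Fin n → List (Fin n)
neighbours {n} m x = filter (λ y → ¬? (y ≟ x) ×-dec (1 ≤? m x y)) (allFin n)

union : ∀ {α n} → ColGraph α n → Mult n
union {α} G x y = sum (map (λ j → G j x y) (allFin α))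

neighboursG : ∀ {α n} → ColGraph α n → Fin n → List (Fin n)
neighboursG G x = neighbours (union G) x

-- A cycle is given by its list of vertices:
--   * a loop  [x]      (at least one loop at x),
--   * a double edge [x , y] with x ≠ y (multiplicity ≥ 2),
--   * a list of ≥ 3 distinct vertices, consecutive ones adjacent and
--     the last adjacent to the first.

Adj : ∀ {n} → Mult n → Fin n → Fin n → Set
Adj m x y = 1 ≤ m x y

IsCycle : ∀ {n} → Mult n → List (Fin n) → Set
IsCycle m [] = ⊥
IsCycle m (x ∷ []) = 1 ≤ m x x
IsCycle m (x ∷ y ∷ []) = x ≢ y × 2 ≤ m x y
IsCycle m (x ∷ y ∷ z ∷ rest) =
  Unique (x ∷ y ∷ z ∷ rest) × Linked (Adj m) (x ∷ y ∷ z ∷ rest ++ [ x ])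

ForestMinus : ∀ {n} → Mult n → Subset n → Set
ForestMinus {n} m S = ¬ (Σ (List (Fin n)) λ c → IsCycle m c × All (λ v → v ∉ S) c)

IsFVS : ∀ {n} → Mult n → Subset n → Set
IsFVS m S = ForestMinus m S

IsSimFVS : ∀ {α n} → ColGraph α n → Subset n → Set
IsSimFVS {α} G S = ∀ (j : Fin α) → ForestMinus (G j) S

HasSimFVSOfSizeAtMost : ∀ {α n} → ColGraph α n → ℕ → Set
HasSimFVSOfSizeAtMost {α} {n} G k = Σ (Subset n) λ S → ∣ S ∣ ≤ k × IsSimFVS G S

ExactlyMeetAt : ∀ {n} → Fin n → List (Fin n) → List (Fin n) → Set
ExactlyMeetAt {n} x c c' =
  (∀ (y : Fin n) → y LMem.∈ c → y LMem.∈ c' → y ≡ x) × (x LMem.∈ c × x LMem.∈ c')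

IsFlower : ∀ {n} → Mult n → Fin n → List (List (Fin n)) → Set
IsFlower m x cs = All (IsCycle m) cs × AllPairs (ExactlyMeetAt x) cs

HasFlowerOfOrderAtLeast : ∀ {n} → Mult n → Fin n → ℕ → Set
HasFlowerOfOrderAtLeast {n} m x r =
  Σ (List (List (Fin n))) λ cs → IsFlower m x cs × r ≤ length cs

InGi' : ∀ {n} → Mult n → Subset n → Fin n → Fin n → Set
InGi' m Hv v x = x ∉ Hv × x ≢ v × deg m x ≢ 0

Adj' : ∀ {n} → Mult n → Subset n → Fin n → Fin n → Fin n → Set
Adj' m Hv v x y = InGi' m Hv v x × InGi' m Hv v y × Adj m x y

IsComponent : ∀ {n} → Mult n → Subset n → Fin n → Subset n → Set
IsComponent {n} m Hv v D =
  (Σ (Fin n) λ x → x ∈ D)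
  × (∀ (x : Fin n) → x ∈ D → InGi' m Hv v x)
  × (∀ (x y : Fin n) → x ∈ D → InGi' m Hv v y → Adj m x y → y ∈ D)
  × (∀ (x y : Fin n) → x ∈ D → y ∈ D → Star (Adj' m Hv v) x y)

InCalD : ∀ {n} → Mult n → Subset n → Fin n → Subset n → Set
InCalD {n} m Hv v D =
  IsComponent m Hv v D × (Σ (Fin n) λ d → d ∈ D × Adj m d v)

BAdj : ∀ {n} → Mult n → Fin n → Subset n → Set
BAdj {n} m h D = Σ (Fin n) λ d → d ∈ D × Adj m d h

-- M ⊆ H × Q' is a q-expansion of H into Q' in ℬ; the vertex q_D is
-- represented by the vertex set D.
IsExpansion : ∀ {n} → Mult n → ℕ → Subset n → List (Subset n)
              → List (Fin n × Subset n) → Set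
IsExpansion {n} m q H Q' M =
  Unique M
  × All (λ e → proj₁ e ∈ H × proj₂ e LMem.∈ Q' × BAdj m (proj₁ e) (proj₂ e)) M
  × (∀ (h : Fin n) → h ∈ H → length (filter (λ e → proj₁ e ≟ h) M) ≡ q)
  × length (deduplicate (≡-dec BoolP._≟_) (map proj₂ M)) ≡ q * ∣ H ∣

inQ' : ∀ {n} → List (Subset n) → Fin n → Bool
inQ' Q' x = does (any? (x ∈?_) Q')

mem : ∀ {n} → Fin n → Subset n → Bool
mem x S = does (x ∈? S)

eqb : ∀ {n} → Fin n → Fin n → Bool
eqb x y = does (x ≟ y)

reduceColor : ∀ {n} → Mult n → Fin n → Subset n → List (Subset n) → Mult n
reduceColor m v H Q' x y =
  if (eqb x v ∧ mem y H) ∨ (eqb y v ∧ mem x H) then 2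
  else if (eqb x v ∧ inQ' Q' y) ∨ (eqb y v ∧ inQ' Q' x) then 0
  else m x y

reduce : ∀ {α n} → ColGraph α n → Fin α → Fin n → Subset n → List (Subset n)
         → ColGraph α n
reduce G i v H Q' j = if does (j ≟ i) then reduceColor (G i) v H Q' else G j

module Submission where

-- Let S be a set of size ≤ k.  The graphs G and G' differ only in
-- colour i and only on edges at v: G' adds the double edges v–h (h ∈ H)
-- and deletes the edges v–d (d in a component D ∈ Q').
--   (→) If S solves G and v ∉ S, then H ⊆ S: otherwise some h ∈ H ∖ S
--       has k + 2 expansion edges to pairwise disjoint components, two of
--       them miss S (pigeonhole), and v–D₁–h–D₂–v is a colour-i cycle
--       avoiding S.  So every added edge meets S and every cycle of G'
--       avoiding S is a cycle of G.
--   (←) If S solves G' and v ∉ S, then H ⊆ S because of the double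
--       edges v–h.  A colour-i cycle of G avoiding S cannot meet a
--       component D ∈ Q': it could only leave D through v (all other
--       exits lie in H ⊆ S), so it would lie in D ∪ {v}, which misses
--       the feedback vertex set H_v.  Hence it uses no deleted edge.

open import Defs
open import Data.Nat using (ℕ; zero; suc; _+_; _*_; _≤_; _<_; z≤n; s≤s)
open import Data.Nat.Properties using (≤-trans; ≤-reflexive; ≤-pred; m≤m+n; m≤n+m; +-monoˡ-≤; +-suc)
open import Data.Nat.ListAction using (sum)
open import Data.Bool using (if_then_else_)
open import Data.Fin using (Fin)
open import Data.Fin.Properties using (_≟_) renaming (any? to anyFin?)
open import Data.Fin.Subset using (Subset; _∈_; _∉_; _⊆_; ∣_∣; _-_)
open import Data.Fin.Subset.Properties using (_∈?_; ⊆-antisym; x∈p⇒∣p-x∣<∣p∣; x∈p∧x≢y⇒x∈p-y)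
open import Data.List using (List; []; _∷_; _++_; [_]; length; filter; map; allFin)
open import Data.List.Properties using (++-assoc; length-map)
open import Data.List.Relation.Unary.All as All using (All; []; _∷_)
import Data.List.Relation.Unary.All.Properties as AllP
open import Data.List.Relation.Unary.Any using (Any; here; there; any?)
open import Data.List.Relation.Unary.AllPairs using ([]; _∷_)
open import Data.List.Relation.Unary.Linked using (Linked; []; [-]; _∷_) renaming (tail to linked-tail)
open import Data.List.Relation.Unary.Unique.Propositional using (Unique)
import Data.List.Relation.Unary.Unique.Propositional.Properties as UniqueP
import Data.List.Membership.Propositional as LMem
open LMem using (find) renaming (_∈_ to _∈ₗ_)
open import Data.List.Membership.Propositional.Properties using (∈-∃++; ∈-++⁻; ∈-++⁺ˡ; ∈-++⁺ʳ; ∈-allFin)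
open import Data.Product using (Σ; _×_; _,_; proj₁; proj₂; map₁)
open import Data.Product.Properties using (×-≡,≡→≡)
open import Data.Sum using (_⊎_; inj₁; inj₂)
open import Data.Empty using (⊥; ⊥-elim)
open import Relation.Nullary using (¬_; Dec; yes; no; does)
open import Relation.Nullary.Decidable using (_×-dec_; _⊎-dec_)
open import Relation.Binary.Definitions using (DecidableEquality)
open import Relation.Binary.PropositionalEquality using (_≡_; _≢_; refl; sym; trans; subst; cong; ≢-sym)
open import Relation.Binary.Construct.Closure.ReflexiveTransitive using (Star; ε; _◅_)
open import Function.Bundles using (_⇔_; mk⇔)

data Ends {A : Set} (y : A) : List A → Set where
  ends-here : Ends y [ y ]
  ends-cons : ∀ {z l} → Ends y l → Ends y (z ∷ l)

ends-suffix : ∀ {A : Set} {y : A} xs {ys} → Ends y (xs ++ ys) → ys ≢ [] → Ends y ys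
ends-suffix [] e ys≢[] = e
ends-suffix (x ∷ []) {[]} e ys≢[] = ⊥-elim (ys≢[] refl)
ends-suffix (x ∷ []) {y ∷ ys} (ends-cons e) ys≢[] = e
ends-suffix (x ∷ x′ ∷ xs) (ends-cons e) ys≢[] = ends-suffix (x′ ∷ xs) e ys≢[]

unique-suffix : ∀ {A : Set} (xs : List A) {ys} → Unique (xs ++ ys) → Unique ys
unique-suffix [] u = u
unique-suffix (x ∷ xs) (_ ∷ u) = unique-suffix xs u

module _ {A : Set} {R : A → A → Set} where

  linked-prefix : ∀ xs {ys} → Linked R (xs ++ ys) → Linked R xs
  linked-prefix [] l = []
  linked-prefix (x ∷ []) l = [-]
  linked-prefix (x ∷ x′ ∷ xs) (r ∷ l) = r ∷ linked-prefix (x′ ∷ xs) l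

  linked-suffix : ∀ xs {ys} → Linked R (xs ++ ys) → Linked R ys
  linked-suffix [] l = l
  linked-suffix (x ∷ xs) l = linked-suffix xs (linked-tail l)

  linked-glue : ∀ xs {y ys} → Linked R (xs ++ [ y ]) → Linked R (y ∷ ys) → Linked R (xs ++ y ∷ ys)
  linked-glue [] l₁ l₂ = l₂
  linked-glue (x ∷ []) (r ∷ [-]) l₂ = r ∷ l₂
  linked-glue (x ∷ x′ ∷ xs) (r ∷ l₁) l₂ = r ∷ linked-glue (x′ ∷ xs) l₁ l₂

  linked-cut : ∀ xs {y ys} → Linked R (xs ++ y ∷ ys) → Linked R (xs ++ [ y ]) × Linked R (y ∷ ys)
  linked-cut [] l = [-] , l
  linked-cut (x ∷ []) (r ∷ l) = (r ∷ [-]) , l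
  linked-cut (x ∷ x′ ∷ xs) (r ∷ l) = let l₁ , l₂ = linked-cut (x′ ∷ xs) l in (r ∷ l₁) , l₂

  linked-extend : ∀ {l b c ys} → Ends b l → Linked R l → R b c → Linked R (c ∷ ys) → Linked R (l ++ c ∷ ys)
  linked-extend ends-here [-] r l₂ = r ∷ l₂
  linked-extend (ends-cons {l = x ∷ _} e) (r₀ ∷ l₁) r l₂ = r₀ ∷ linked-extend e l₁ r l₂

  rotate : ∀ {v} pre post {y t} → pre ++ v ∷ post ≡ y ∷ t
         → Linked R (y ∷ t ++ [ y ]) → Linked R (v ∷ post ++ pre ++ [ v ])
  rotate [] post refl l = l
  rotate {v} (a ∷ pre) post refl l =
    let l₁ , l₂ = linked-cut (a ∷ pre) (subst (λ z → Linked R (a ∷ z)) (++-assoc pre (v ∷ post) [ a ]) l)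
    in linked-glue (v ∷ post) l₂ l₁

record SimplePath {A : Set} (R : A → A → Set) (P : A → Set) (x y : A) : Set where
  field
    inner  : List A
    ends   : Ends y (x ∷ inner)
    linked : Linked R (x ∷ inner)
    unique : Unique (x ∷ inner)
    inside : All P (x ∷ inner)
open SimplePath

-- Loop erasure: a walk along R′ ⊆ R staying in an R′-closed set P
-- contains a simple R-path between its endpoints inside P.
simple-path : ∀ {A : Set} → DecidableEquality A → ∀ {R′ R : A → A → Set} {P : A → Set}
  → (∀ {a b} → R′ a b → R a b) → (∀ {a b} → P a → R′ a b → P b)
  → ∀ {x y} → P x → Star R′ x y → SimplePath R P x y
simple-path _ sub closed px ε =
  record { inner = [] ; ends = ends-here ; linked = [-] ; unique = [] ∷ [] ; inside = px ∷ [] }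
simple-path _≟ₐ_ sub closed {x} px (_◅_ {j = z} r walk)
  with simple-path _≟ₐ_ sub closed (closed px r) walk
... | p with any? (x ≟ₐ_) (z ∷ inner p)
...   | no x∉ = record
  { inner = z ∷ inner p ; ends = ends-cons (ends p) ; linked = sub r ∷ linked p
  ; unique = AllP.¬Any⇒All¬ _ x∉ ∷ unique p ; inside = px ∷ inside p }
...   | yes x∈ with ∈-∃++ x∈
...     | pre , post , eq = record -- x reappears: erase the loop back to x
  { inner = post
  ; ends = ends-suffix pre (subst (Ends _) eq (ends p)) (λ ())
  ; linked = linked-suffix pre (subst (Linked _) eq (linked p))
  ; unique = unique-suffix pre (subst Unique eq (unique p))
  ; inside = AllP.++⁻ʳ pre (subst (All _) eq (inside p)) }

module Spreading {A : Set} {R : A → A → Set} (R-sym : ∀ {x y} → R x y → R y x)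
                 {P C : A → Set} (step : ∀ {y z} → P y → R y z → C z → P z) where

  spread-forward : ∀ {x ys} → Linked R (x ∷ ys) → P x → All C ys → All P ys
  spread-forward [-] px [] = []
  spread-forward (r ∷ l) px (c ∷ cs) = let py = step px r c in py ∷ spread-forward l py cs

  spread-backward : ∀ xs {x ys} → Linked R (xs ++ x ∷ ys) → P x → All C xs → All P xs
  spread-backward [] l px [] = []
  spread-backward (a ∷ []) (r ∷ l) px (c ∷ []) = step px (R-sym r) c ∷ []
  spread-backward (a ∷ a′ ∷ xs) (r ∷ l) px (c ∷ cs) with spread-backward (a′ ∷ xs) l px cs
  ... | pa′ ∷ ps = step pa′ (R-sym r) c ∷ pa′ ∷ ps

  spread : ∀ {l} → Linked R l → All C l → ∀ {x} → x ∈ₗ l → P x → All P l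
  spread l cs x∈l px with ∈-∃++ x∈l
  ... | pre , post , refl =
    AllP.++⁺ (spread-backward pre l px (AllP.++⁻ˡ pre cs))
             (px ∷ spread-forward (linked-suffix pre l) px (All.tail (AllP.++⁻ʳ pre cs)))

around-unique : ∀ {A : Set} {v : A} pre {post} → Unique (pre ++ v ∷ post) → All (_≢ v) pre × All (v ≢_) post
around-unique [] (v∉ ∷ _) = [] , v∉
around-unique (p ∷ pre) (p∉ ∷ u) =
  let l , r = around-unique pre u in All.lookup p∉ (∈-++⁺ʳ pre (here refl)) ∷ l , r

module Confinement {A : Set} {R : A → A → Set} (R-sym : ∀ {x y} → R x y → R y x)
  {P C : A → Set} (v : A) (step : ∀ {y z} → P y → R y z → z ≢ v → C z → P z)
  (P≢v : ∀ {z} → P z → z ≢ v) where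

  open Spreading R-sym {P} {λ z → z ≢ v × C z} (λ py r (z≢v , cz) → step py r z≢v cz)

  -- Rotated to start at v, the walk v post pre v minus v is a walk avoiding
  -- v, along which P spreads from x to every vertex.
  rotated-confined : ∀ pre post → Unique (pre ++ v ∷ post) → Linked R (v ∷ post ++ pre ++ [ v ])
    → All C (pre ++ v ∷ post) → ∀ {x} → x ∈ₗ pre ++ v ∷ post → P x
    → All (λ z → z ≡ v ⊎ P z) (pre ++ v ∷ post)
  rotated-confined pre post u closed cs {x} x∈c px =
    AllP.++⁺ (All.map inj₂ (AllP.++⁻ʳ post rest-in-P)) (inj₁ refl ∷ All.map inj₂ (AllP.++⁻ˡ post rest-in-P))
    where
    rest : List A
    rest = post ++ pre
    rest-linked : Linked R rest
    rest-linked = linked-prefix rest (subst (Linked R) (sym (++-assoc post pre [ v ])) (linked-tail closed))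
    rest-ok : All (λ z → z ≢ v × C z) rest
    rest-ok = let pre≢v , post≢v = around-unique pre u in
      AllP.++⁺ (All.zip (All.map ≢-sym post≢v , All.tail (AllP.++⁻ʳ pre cs)))
               (All.zip (pre≢v , AllP.++⁻ˡ pre cs))
    x∈rest : x ∈ₗ rest
    x∈rest with ∈-++⁻ pre x∈c
    ... | inj₁ x∈pre = ∈-++⁺ʳ post x∈pre
    ... | inj₂ (here refl) = ⊥-elim (P≢v px refl)
    ... | inj₂ (there x∈post) = ∈-++⁺ˡ x∈post
    rest-in-P : All P rest
    rest-in-P = spread rest-linked rest-ok x∈rest px

  closed-walk-confined : DecidableEquality A → ∀ {y t} → Unique (y ∷ t) → Linked R (y ∷ t ++ [ y ])
    → All C (y ∷ t) → ∀ {x} → x ∈ₗ y ∷ t → P x → All (λ z → z ≡ v ⊎ P z) (y ∷ t)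
  closed-walk-confined _≟ₐ_ {y} {t} u closed cs {x} x∈c px with any? (v ≟ₐ_) (y ∷ t)
  ... | no v∉c =
    All.map inj₂ (spread (linked-prefix (y ∷ t) closed) (All.zip (All.map ≢-sym (AllP.¬Any⇒All¬ _ v∉c) , cs)) x∈c px)
  ... | yes v∈c with ∈-∃++ v∈c
  ...   | pre , post , eq =
    subst (All (λ z → z ≡ v ⊎ P z)) (sym eq)
      (rotated-confined pre post (subst Unique eq u) (rotate pre post (sym eq) closed)
                        (subst (All C) eq cs) (subst (x ∈ₗ_) eq x∈c) px)

SymmetricMult : ∀ {n} → Mult n → Set
SymmetricMult {n} m = ∀ (x y : Fin n) → m x y ≡ m y x

adj-sym : ∀ {n} {m : Mult n} → SymmetricMult m → ∀ {x y} → Adj m x y → Adj m y x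
adj-sym m-sym {x} {y} = subst (1 ≤_) (m-sym x y)

cycle-closed-walk : ∀ {n} {m : Mult n} → SymmetricMult m → ∀ y t
  → IsCycle m (y ∷ t) → Unique (y ∷ t) × Linked (Adj m) (y ∷ t ++ [ y ])
cycle-closed-walk m-sym y [] loop = [] ∷ [] , loop ∷ [-]
cycle-closed-walk m-sym y (z ∷ []) (y≢z , double) =
  let yz = ≤-trans (s≤s z≤n) double in ((y≢z ∷ []) ∷ [] ∷ []) , yz ∷ adj-sym m-sym yz ∷ [-]
cycle-closed-walk m-sym y (z ∷ w ∷ t) cyc = cyc

cycle-mono : ∀ {n} {m m′ : Mult n} {Q : Fin n → Set}
  → (∀ {x y} → Q x → Q y → m x y ≤ m′ x y)
  → ∀ c → IsCycle m c → All Q c → IsCycle m′ c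
cycle-mono mono (x ∷ []) loop (qx ∷ []) = ≤-trans loop (mono qx qx)
cycle-mono mono (x ∷ y ∷ []) (x≢y , double) (qx ∷ qy ∷ []) = x≢y , ≤-trans double (mono qx qy)
cycle-mono {m = m} {m′} {Q} mono (x ∷ y ∷ z ∷ rest) (u , l) qs@(qx ∷ _) = u , walk (AllP.++⁺ qs (qx ∷ [])) l
  where
  walk : ∀ {l} → All Q l → Linked (Adj m) l → Linked (Adj m′) l
  walk [] [] = []
  walk (_ ∷ []) [-] = [-]
  walk (qa ∷ qb ∷ qs′) (r ∷ l′) = ≤-trans r (mono qa qb) ∷ walk (qb ∷ qs′) l′

long-cycle : ∀ {n} {m : Mult n} x y zs → zs ≢ [] → Unique (x ∷ y ∷ zs)
  → Linked (Adj m) (x ∷ y ∷ zs ++ [ x ]) → IsCycle m (x ∷ y ∷ zs)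
long-cycle x y [] zs≢[] u l = ⊥-elim (zs≢[] refl)
long-cycle x y (z ∷ zs) zs≢[] u l = u , l

simfvs-transfer : ∀ {α n} {G₁ G₂ : ColGraph α n} {S : Subset n}
  → (∀ j c → IsCycle (G₂ j) c → All (_∉ S) c → IsCycle (G₁ j) c) → IsSimFVS G₁ S → IsSimFVS G₂ S
simfvs-transfer cycles sol j (c , cyc , avoid) = sol j (c , cycles j c cyc avoid , avoid)

Disjoint : ∀ {n} → Subset n → Subset n → Set
Disjoint {n} D D′ = ∀ {y : Fin n} → y ∈ D → y ∉ D′

avoiding-members : ∀ {n} {P : Subset n → Set}
  → (∀ {D D′} → P D → P D′ → D ≢ D′ → Disjoint D D′)
  → ∀ (Ds : List (Subset n)) → All P Ds → Unique Ds → ∀ r (S : Subset n) → ∣ S ∣ + r ≤ length Ds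
  → Σ (List (Subset n)) λ L → length L ≡ r × Unique L × All (λ D → D ∈ₗ Ds × Disjoint D S) L
avoiding-members disj [] ps u zero S size = [] , refl , [] , []
avoiding-members disj [] ps u (suc r) S size with ≤-trans (m≤n+m (suc r) ∣ S ∣) size
... | ()
avoiding-members disj (D ∷ Ds) (pD ∷ ps) (D∉ ∷ u) r S size
  with anyFin? (λ y → (y ∈? D) ×-dec (y ∈? S))
... | no D-misses-S with r
...   | zero = [] , refl , [] , []
...   | suc r′ with avoiding-members disj Ds ps u r′ S (≤-pred (subst (_≤ suc (length Ds)) (+-suc ∣ S ∣ r′) size))
...     | L , len , uL , aL =
  D ∷ L , cong suc len ,
  All.map (λ (D′∈ , _) D≡D′ → All.lookup D∉ D′∈ D≡D′) aL ∷ uL ,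
  (here refl , λ y∈D y∈S → D-misses-S (_ , y∈D , y∈S)) ∷ All.map (map₁ there) aL
avoiding-members disj (D ∷ Ds) (pD ∷ ps) (D∉ ∷ u) r S size | yes (y , y∈D , y∈S)
  with avoiding-members disj Ds ps u r (S - y) (≤-pred (≤-trans (+-monoˡ-≤ r (x∈p⇒∣p-x∣<∣p∣ y∈S)) size))
... | L , len , uL , aL = L , len , uL , All.map widen aL
  where
  -- y lies in D, hence in no other member, so avoiding S - y means avoiding S
  widen : ∀ {D′} → D′ ∈ₗ Ds × Disjoint D′ (S - y) → D′ ∈ₗ D ∷ Ds × Disjoint D′ S
  widen {D′} (D′∈ , free) = there D′∈ , avoid
    where
    avoid : Disjoint D′ S
    avoid {z} z∈D′ z∈S with z ≟ y
    ... | yes refl = disj pD (All.lookup ps D′∈) (All.lookup D∉ D′∈) y∈D z∈D′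
    ... | no z≢y = free z∈D′ (x∈p∧x≢y⇒x∈p-y z∈S z≢y)

unique-proj₂ : ∀ {A B : Set} {a : A} {es : List (A × B)}
  → All (λ e → proj₁ e ≡ a) es → Unique es → Unique (map proj₂ es)
unique-proj₂ [] [] = []
unique-proj₂ (p ∷ ps) (e∉ ∷ u) =
  AllP.map⁺ (All.zipWith (λ (e≢e′ , p′) same → e≢e′ (×-≡,≡→≡ (trans p (sym p′) , same))) (e∉ , ps))
  ∷ unique-proj₂ ps u

if-dec : ∀ {P B : Set} (d : Dec P) (a b : B)
  → (P × (if does d then a else b) ≡ a) ⊎ (¬ P × (if does d then a else b) ≡ b)
if-dec (yes p) a b = inj₁ (p , refl)
if-dec (no ¬p) a b = inj₂ (¬p , refl)

-- {x, y} = {v, h} for some h ∈ H: the pairs that become double edges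
ToH : ∀ {n} → Fin n → Subset n → Fin n → Fin n → Set
ToH v H x y = (x ≡ v × y ∈ H) ⊎ (y ≡ v × x ∈ H)

InUnion : ∀ {n} → List (Subset n) → Fin n → Set
InUnion Q' x = Any (x ∈_) Q'

-- {x, y} = {v, d} for d in a component of Q': the pairs whose edges are deleted
ToQ : ∀ {n} → Fin n → List (Subset n) → Fin n → Fin n → Set
ToQ v Q' x y = (x ≡ v × InUnion Q' y) ⊎ (y ≡ v × InUnion Q' x)

-- The boolean tests of reduceColor are (definitionally) these decisions.
toH? : ∀ {n} (v : Fin n) H x y → Dec (ToH v H x y)
toH? v H x y = ((x ≟ v) ×-dec (y ∈? H)) ⊎-dec ((y ≟ v) ×-dec (x ∈? H))

toQ? : ∀ {n} (v : Fin n) Q' x y → Dec (ToQ v Q' x y)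
toQ? v Q' x y = ((x ≟ v) ×-dec any? (y ∈?_) Q') ⊎-dec ((y ≟ v) ×-dec any? (x ∈?_) Q')

data ReduceColorView {n} (m : Mult n) (v : Fin n) (H : Subset n) (Q' : List (Subset n)) (x y : Fin n) : Set where
  doubled : ToH v H x y → reduceColor m v H Q' x y ≡ 2 → ReduceColorView m v H Q' x y
  deleted : ¬ ToH v H x y → ToQ v Q' x y → reduceColor m v H Q' x y ≡ 0 → ReduceColorView m v H Q' x y
  kept    : ¬ ToH v H x y → ¬ ToQ v Q' x y → reduceColor m v H Q' x y ≡ m x y → ReduceColorView m v H Q' x y

reduceColor-view : ∀ {n} (m : Mult n) v H Q' x y → ReduceColorView m v H Q' x y
reduceColor-view m v H Q' x y with if-dec (toH? v H x y) 2 (if does (toQ? v Q' x y) then 0 else m x y)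
... | inj₁ (toH , eq) = doubled toH eq
... | inj₂ (¬toH , eq) with if-dec (toQ? v Q' x y) 0 (m x y)
...   | inj₁ (toQ , eq′) = deleted ¬toH toQ (trans eq eq′)
...   | inj₂ (¬toQ , eq′) = kept ¬toH ¬toQ (trans eq eq′)

reduce-colour : ∀ {α n} (G : ColGraph α n) i v H Q' j
  → (j ≡ i × reduce G i v H Q' j ≡ reduceColor (G i) v H Q') ⊎ (j ≢ i × reduce G i v H Q' j ≡ G j)
reduce-colour G i v H Q' j = if-dec (j ≟ i) (reduceColor (G i) v H Q') (G j)

module _ {α n} (G : ColGraph α n) (i : Fin α) (v : Fin n) (H : Subset n) (Q' : List (Subset n)) where

  reduce-≤ : ∀ j {x y} → ¬ ToH v H x y → reduce G i v H Q' j x y ≤ G j x y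
  reduce-≤ j {x} {y} ¬toH with reduce-colour G i v H Q' j
  ... | inj₂ (_ , eq) = ≤-reflexive (cong (λ m → m x y) eq)
  ... | inj₁ (refl , eq) with reduceColor-view (G i) v H Q' x y
  ...   | doubled toH _ = ⊥-elim (¬toH toH)
  ...   | deleted _ _ red≡0 = subst (_≤ G i x y) (sym (trans (cong (λ m → m x y) eq) red≡0)) z≤n
  ...   | kept _ _ red≡m = ≤-reflexive (trans (cong (λ m → m x y) eq) red≡m)

  -- Away from the deleted edges, the reduction only adds edges
  -- (new multiplicities are 2, old ones at most 2).
  reduce-≥ : MultAtMost2 G → ∀ j {x y} → (j ≡ i → ¬ ToQ v Q' x y) → G j x y ≤ reduce G i v H Q' j x y
  reduce-≥ ≤2 j {x} {y} ¬toQ with reduce-colour G i v H Q' j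
  ... | inj₂ (_ , eq) = ≤-reflexive (sym (cong (λ m → m x y) eq))
  ... | inj₁ (refl , eq) with reduceColor-view (G i) v H Q' x y
  ...   | doubled _ red≡2 = subst (G i x y ≤_) (sym (trans (cong (λ m → m x y) eq) red≡2)) (≤2 i x y)
  ...   | deleted _ toQ _ = ⊥-elim (¬toQ refl toQ)
  ...   | kept _ _ red≡m = ≤-reflexive (sym (trans (cong (λ m → m x y) eq) red≡m))

  reduce-double : ∀ {h} → h ∈ H → reduce G i v H Q' i v h ≡ 2
  reduce-double {h} h∈H with reduce-colour G i v H Q' i
  ... | inj₂ (i≢i , _) = ⊥-elim (i≢i refl)
  ... | inj₁ (_ , eq) with reduceColor-view (G i) v H Q' v h
  ...   | doubled _ red≡2 = trans (cong (λ m → m v h) eq) red≡2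
  ...   | deleted ¬toH _ _ = ⊥-elim (¬toH (inj₁ (refl , h∈H)))
  ...   | kept ¬toH _ _ = ⊥-elim (¬toH (inj₁ (refl , h∈H)))

≤-sum : ∀ {n} (f : Fin n → ℕ) {y} xs → y ∈ₗ xs → f y ≤ sum (map f xs)
≤-sum f (x ∷ xs) (here refl) = m≤m+n _ _
≤-sum f (x ∷ xs) (there y∈) = ≤-trans (≤-sum f xs y∈) (m≤n+m _ _)

adj⇒deg≢0 : ∀ {n} {m : Mult n} {x y} → Adj m x y → deg m x ≢ 0
adj⇒deg≢0 {n} {m} {x} {y} xy deg≡0 with
  subst (1 ≤_) deg≡0 (≤-trans xy (≤-trans (≤-sum (m x) (allFin n) (∈-allFin y)) (m≤m+n _ (m x x))))
... | ()

module _ {n} {m : Mult n} {Hv : Subset n} {v : Fin n} {D : Subset n} (D∈𝒟 : InCalD m Hv v D) where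

  comp-inside : ∀ {x} → x ∈ D → InGi' m Hv v x
  comp-inside x∈ = proj₁ (proj₂ (proj₁ D∈𝒟)) _ x∈

  comp-closed : ∀ {x y} → x ∈ D → InGi' m Hv v y → Adj m x y → y ∈ D
  comp-closed x∈ y-in xy = proj₁ (proj₂ (proj₂ (proj₁ D∈𝒟))) _ _ x∈ y-in xy

  comp-connected : ∀ {x y} → x ∈ D → y ∈ D → Star (Adj' m Hv v) x y
  comp-connected x∈ y∈ = proj₂ (proj₂ (proj₂ (proj₁ D∈𝒟))) _ _ x∈ y∈

  comp-attached : Σ (Fin n) λ d → d ∈ D × Adj m d v
  comp-attached = proj₂ D∈𝒟

  comp-walk : ∀ {x y} → x ∈ D → Star (Adj' m Hv v) x y → y ∈ D
  comp-walk x∈ ε = x∈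
  comp-walk x∈ ((_ , y-in , xy) ◅ walk) = comp-walk (comp-closed x∈ y-in xy) walk

glue-cycle : ∀ {n} {m : Mult n} → SymmetricMult m → ∀ {D₁ D₂ : Subset n} {v h a₁ b₁ a₂ b₂}
  → Disjoint D₁ D₂ → v ∉ D₁ → v ∉ D₂ → h ∉ D₁ → h ∉ D₂ → v ≢ h
  → SimplePath (Adj m) (_∈ D₁) a₁ b₁ → SimplePath (Adj m) (_∈ D₂) b₂ a₂
  → Adj m a₁ v → Adj m b₁ h → Adj m b₂ h → Adj m a₂ v
  → Σ (List (Fin n)) λ c → IsCycle m c × All (λ z → z ≡ v ⊎ z ≡ h ⊎ z ∈ D₁ ⊎ z ∈ D₂) c
glue-cycle {n} {m} m-sym {D₁} {D₂} {v} {h} {a₁} {b₁} {a₂} {b₂}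
  disj v∉D₁ v∉D₂ h∉D₁ h∉D₂ v≢h p₁ p₂ a₁v b₁h b₂h a₂v =
  v ∷ a₁ ∷ tail , cycle , inj₁ refl ∷ All.tabulate (λ z∈ → inj₂ (W-vertices z∈))
  where
  path₁ path₂ tail W : List (Fin n)
  path₁ = a₁ ∷ inner p₁
  path₂ = b₂ ∷ inner p₂
  tail = inner p₁ ++ h ∷ path₂
  -- the cycle without v
  W = path₁ ++ h ∷ path₂

  W-vertices : ∀ {z} → z ∈ₗ W → z ≡ h ⊎ z ∈ D₁ ⊎ z ∈ D₂
  W-vertices z∈ with ∈-++⁻ path₁ z∈
  ... | inj₁ z∈₁ = inj₂ (inj₁ (All.lookup (inside p₁) z∈₁))
  ... | inj₂ (here z≡h) = inj₁ z≡h
  ... | inj₂ (there z∈₂) = inj₂ (inj₂ (All.lookup (inside p₂) z∈₂))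

  W-unique : Unique W
  W-unique = UniqueP.++⁺ (unique p₁)
    (All.map (λ z∈D₂ h≡z → h∉D₂ (subst (_∈ D₂) (sym h≡z) z∈D₂)) (inside p₂) ∷ unique p₂) apart
    where
    apart : ∀ {z} → ¬ (z ∈ₗ path₁ × z ∈ₗ h ∷ path₂)
    apart (z∈₁ , here refl) = h∉D₁ (All.lookup (inside p₁) z∈₁)
    apart (z∈₁ , there z∈₂) = disj (All.lookup (inside p₁) z∈₁) (All.lookup (inside p₂) z∈₂)

  v∉W : All (v ≢_) W
  v∉W = All.tabulate λ z∈ v≡z → case (W-vertices z∈) v≡z
    where
    case : ∀ {z} → z ≡ h ⊎ z ∈ D₁ ⊎ z ∈ D₂ → v ≢ z
    case (inj₁ refl) = v≢h
    case (inj₂ (inj₁ z∈)) refl = v∉D₁ z∈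
    case (inj₂ (inj₂ z∈)) refl = v∉D₂ z∈

  closed : Linked (Adj m) (v ∷ a₁ ∷ tail ++ [ v ])
  closed = adj-sym m-sym a₁v ∷ subst (Linked (Adj m)) (sym (++-assoc path₁ (h ∷ path₂) [ v ]))
    (linked-extend (ends p₁) (linked p₁) b₁h
      (adj-sym m-sym b₂h ∷ linked-extend (ends p₂) (linked p₂) a₂v [-]))

  tail≢[] : tail ≢ []
  tail≢[] with inner p₁
  ... | [] = λ ()
  ... | _ ∷ _ = λ ()

  cycle : IsCycle m (v ∷ a₁ ∷ tail)
  cycle = long-cycle v a₁ tail tail≢[] (v∉W ∷ W-unique) closed

matched-components : ∀ {n} {m : Mult n} {q H Q'} → Σ (List (Fin n × Subset n)) (IsExpansion m q H Q')
  → ∀ {h} → h ∈ H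
  → Σ (List (Subset n)) λ Ds → length Ds ≡ q × Unique Ds × All (λ D → D ∈ₗ Q' × BAdj m h D) Ds
matched-components {n} {m} {q} {H} {Q'} (M , M-unique , M-edges , M-degree , _) {h} h∈H =
  map proj₂ Mh ,
  trans (length-map proj₂ Mh) (M-degree h h∈H) ,
  unique-proj₂ at-h (UniqueP.filter⁺ (λ e → proj₁ e ≟ h) M-unique) ,
  AllP.map⁺ (All.zipWith adjacent (at-h , AllP.filter⁺ (λ e → proj₁ e ≟ h) M-edges))
  where
  Mh : List (Fin n × Subset n)
  Mh = filter (λ e → proj₁ e ≟ h) M
  at-h : All (λ e → proj₁ e ≡ h) Mh
  at-h = AllP.all-filter (λ e → proj₁ e ≟ h) M
  adjacent : ∀ {e : Fin n × Subset n} → proj₁ e ≡ h × proj₁ e ∈ H × proj₂ e ∈ₗ Q' × BAdj m (proj₁ e) (proj₂ e)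
    → proj₂ e ∈ₗ Q' × BAdj m h (proj₂ e)
  adjacent (refl , _ , D∈ , adj) = D∈ , adj

module Components {n} (m : Mult n) (m-sym : SymmetricMult m)
  (Hv : Subset n) (v : Fin n) (v∉Hv : v ∉ Hv)
  (H : Subset n) (H⊆Hv : H ⊆ Hv) (Q' : List (Subset n))
  (Q'⊆𝒟 : All (InCalD m Hv v) Q')
  (H-closed : ∀ (D : Subset n) → D ∈ₗ Q' → ∀ (h : Fin n) → h ∈ Hv → BAdj m h D → h ∈ H)
  where

  in-𝒟 : ∀ {D} → D ∈ₗ Q' → InCalD m Hv v D
  in-𝒟 = All.lookup Q'⊆𝒟

  step-out : ∀ {D y z} → D ∈ₗ Q' → y ∈ D → Adj m y z → z ≢ v → z ∉ H → z ∈ D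
  step-out {D} {y} {z} D∈ y∈ yz z≢v z∉H with z ∈? Hv
  ... | yes z∈Hv = ⊥-elim (z∉H (H-closed D D∈ z z∈Hv (y , y∈ , yz)))
  ... | no z∉Hv = comp-closed (in-𝒟 D∈) y∈ (z∉Hv , z≢v , adj⇒deg≢0 {m = m} (adj-sym m-sym yz)) yz

  disjoint : ∀ {D D′} → D ∈ₗ Q' → D′ ∈ₗ Q' → D ≢ D′ → Disjoint D D′
  disjoint D∈ D′∈ D≢D′ x∈D x∈D′ =
    D≢D′ (⊆-antisym (λ y∈ → comp-walk (in-𝒟 D′∈) x∈D′ (comp-connected (in-𝒟 D∈) x∈D y∈))
                    (λ y∈ → comp-walk (in-𝒟 D∈) x∈D (comp-connected (in-𝒟 D′∈) x∈D′ y∈)))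

  path-inside : ∀ {D x y} → D ∈ₗ Q' → x ∈ D → y ∈ D → SimplePath (Adj m) (_∈ D) x y
  path-inside D∈ x∈ y∈ =
    simple-path _≟_ (λ (_ , _ , xy) → xy) (λ x∈′ (_ , y-in , xy) → comp-closed (in-𝒟 D∈) x∈′ y-in xy)
                x∈ (comp-connected (in-𝒟 D∈) x∈ y∈)

  cycle-through : ∀ {h D₁ D₂} → h ∈ Hv → D₁ ∈ₗ Q' → D₂ ∈ₗ Q' → D₁ ≢ D₂ → BAdj m h D₁ → BAdj m h D₂
    → Σ (List (Fin n)) λ c → IsCycle m c × All (λ z → z ≡ v ⊎ z ≡ h ⊎ z ∈ D₁ ⊎ z ∈ D₂) c
  cycle-through {h} h∈Hv D₁∈ D₂∈ D₁≢D₂ (b₁ , b₁∈ , b₁h) (b₂ , b₂∈ , b₂h) =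
    let a₁ , a₁∈ , a₁v = comp-attached (in-𝒟 D₁∈)
        a₂ , a₂∈ , a₂v = comp-attached (in-𝒟 D₂∈)
    in glue-cycle m-sym (disjoint D₁∈ D₂∈ D₁≢D₂) (v∉ D₁∈) (v∉ D₂∈) (h∉ D₁∈) (h∉ D₂∈)
                  (λ v≡h → v∉Hv (subst (_∈ Hv) (sym v≡h) h∈Hv))
                  (path-inside D₁∈ a₁∈ b₁∈) (path-inside D₂∈ b₂∈ a₂∈) a₁v b₁h b₂h a₂v
    where
    v∉ : ∀ {D} → D ∈ₗ Q' → v ∉ D
    v∉ D∈ v∈ = proj₁ (proj₂ (comp-inside (in-𝒟 D∈) v∈)) refl
    h∉ : ∀ {D} → D ∈ₗ Q' → h ∉ D
    h∉ D∈ h∈ = proj₁ (comp-inside (in-𝒟 D∈) h∈) h∈Hv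

  H⊆solution : ∀ {k} → Σ (List (Fin n × Subset n)) (IsExpansion m (k + 2) H Q')
    → ∀ {S} → ∣ S ∣ ≤ k → v ∉ S → ForestMinus m S → H ⊆ S
  H⊆solution {k} expansion {S} |S|≤k v∉S forest {h} h∈H with h ∈? S
  ... | yes h∈S = h∈S
  ... | no h∉S with matched-components expansion h∈H
  ...   | Ds , |Ds| , Ds-unique , Ds-adjacent
    with avoiding-members (λ p p′ → disjoint (proj₁ p) (proj₁ p′)) Ds Ds-adjacent Ds-unique 2 S
           (subst (∣ S ∣ + 2 ≤_) (sym |Ds|) (+-monoˡ-≤ 2 |S|≤k))
  ...     | D₁ ∷ D₂ ∷ [] , refl , (D₁≢D₂ ∷ []) ∷ _ , (D₁∈ , D₁-free) ∷ (D₂∈ , D₂-free) ∷ [] =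
    let D₁∈Q' , h-D₁ = All.lookup Ds-adjacent D₁∈
        D₂∈Q' , h-D₂ = All.lookup Ds-adjacent D₂∈
        c , cyc , on-cycle = cycle-through (H⊆Hv h∈H) D₁∈Q' D₂∈Q' D₁≢D₂ h-D₁ h-D₂
        avoid : ∀ {z} → z ≡ v ⊎ z ≡ h ⊎ z ∈ D₁ ⊎ z ∈ D₂ → z ∉ S
        avoid = λ { (inj₁ refl) → v∉S ; (inj₂ (inj₁ refl)) → h∉S
                  ; (inj₂ (inj₂ (inj₁ z∈))) → D₁-free z∈ ; (inj₂ (inj₂ (inj₂ z∈))) → D₂-free z∈ }
    in ⊥-elim (forest (c , cyc , All.map avoid on-cycle))

  -- Backward key fact: if H ⊆ S and v ∉ S, a cycle avoiding S meets no
  -- component of Q' (it would lie in D ∪ {v}, missing the FVS H_v).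
  cycle-misses-Q' : IsFVS m Hv → ∀ {S} → H ⊆ S → v ∉ S
    → ∀ {c} → IsCycle m c → All (_∉ S) c → All (λ x → ¬ InUnion Q' x) c
  cycle-misses-Q' Hv-fvs {S} H⊆S v∉S {[]} () avoid
  cycle-misses-Q' Hv-fvs {S} H⊆S v∉S {y ∷ t} cyc avoid = All.tabulate λ x∈c x∈⋃ →
    let D , D∈ , x∈D = find x∈⋃ in
    Hv-fvs (y ∷ t , cyc , All.map (outside-Hv D∈) (confined D∈ x∈c x∈D))
    where
    closed-walk : Unique (y ∷ t) × Linked (Adj m) (y ∷ t ++ [ y ])
    closed-walk = cycle-closed-walk m-sym y t cyc
    confined : ∀ {D x} → D ∈ₗ Q' → x ∈ₗ y ∷ t → x ∈ D → All (λ z → z ≡ v ⊎ z ∈ D) (y ∷ t)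
    confined {D} D∈ x∈c x∈D =
      Confinement.closed-walk-confined (adj-sym m-sym) {P = _∈ D} {C = _∉ S} v
        (λ y∈D yz z≢v z∉S → step-out D∈ y∈D yz z≢v (λ z∈H → z∉S (H⊆S z∈H)))
        (λ z∈D → proj₁ (proj₂ (comp-inside (in-𝒟 D∈) z∈D)))
        _≟_ (proj₁ closed-walk) (proj₂ closed-walk) avoid x∈c x∈D
    outside-Hv : ∀ {D z} → D ∈ₗ Q' → z ≡ v ⊎ z ∈ D → z ∉ Hv
    outside-Hv D∈ (inj₁ refl) = v∉Hv
    outside-Hv D∈ (inj₂ z∈D) = proj₁ (comp-inside (in-𝒟 D∈) z∈D)

not-deleted-away-from-v : ∀ {n} {v : Fin n} {Q' x y} → x ≢ v → y ≢ v → ¬ ToQ v Q' x y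
not-deleted-away-from-v x≢v y≢v (inj₁ (x≡v , _)) = x≢v x≡v
not-deleted-away-from-v x≢v y≢v (inj₂ (y≡v , _)) = y≢v y≡v

not-deleted-outside-Q' : ∀ {n} {v : Fin n} {Q' x y} → ¬ InUnion Q' x → ¬ InUnion Q' y → ¬ ToQ v Q' x y
not-deleted-outside-Q' x∉⋃ y∉⋃ (inj₁ (_ , y∈⋃)) = y∉⋃ y∈⋃
not-deleted-outside-Q' x∉⋃ y∉⋃ (inj₂ (_ , x∈⋃)) = x∉⋃ x∈⋃

module Directions {α n} (G : ColGraph α n) (k : ℕ) (G-sym : Symmetric G) (≤2 : MultAtMost2 G)
  (i : Fin α) (v : Fin n) (Hv : Subset n) (v∉Hv : v ∉ Hv) (Hv-fvs : IsFVS (G i) Hv)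
  (H : Subset n) (H⊆Hv : H ⊆ Hv) (Q' : List (Subset n))
  (Q'⊆𝒟 : All (InCalD (G i) Hv v) Q')
  (H-closed : ∀ (D : Subset n) → D ∈ₗ Q' → ∀ (h : Fin n) → h ∈ Hv → BAdj (G i) h D → h ∈ H)
  where

  open Components (G i) (G-sym i) Hv v v∉Hv H H⊆Hv Q' Q'⊆𝒟 H-closed

  G' : ColGraph α n
  G' = reduce G i v H Q'

  -- A solution of G solves G': every new edge v–h has an endpoint in S.
  forward : Σ (List (Fin n × Subset n)) (IsExpansion (G i) (k + 2) H Q')
    → HasSimFVSOfSizeAtMost G k → HasSimFVSOfSizeAtMost G' k
  forward expansion (S , |S|≤k , S-sol) =
    S , |S|≤k , simfvs-transfer (λ j c → cycle-mono (λ x∉S y∉S → reduce-≤ G i v H Q' j (new-edge-hits x∉S y∉S)) c) S-sol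
    where
    v-or-H : v ∈ S ⊎ H ⊆ S
    v-or-H with v ∈? S
    ... | yes v∈S = inj₁ v∈S
    ... | no v∉S = inj₂ (H⊆solution expansion |S|≤k v∉S (S-sol i))
    new-edge-hits : ∀ {x y} → x ∉ S → y ∉ S → ¬ ToH v H x y
    new-edge-hits x∉S y∉S toH with v-or-H | toH
    ... | inj₁ v∈S | inj₁ (refl , _) = x∉S v∈S
    ... | inj₁ v∈S | inj₂ (refl , _) = y∉S v∈S
    ... | inj₂ H⊆S | inj₁ (_ , y∈H) = y∉S (H⊆S y∈H)
    ... | inj₂ H⊆S | inj₂ (_ , x∈H) = x∉S (H⊆S x∈H)

  -- A solution of G' solves G: a cycle avoiding S uses no deleted edge.
  backward : HasSimFVSOfSizeAtMost G' k → HasSimFVSOfSizeAtMost G k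
  backward (S , |S|≤k , S-sol) = S , |S|≤k , simfvs-transfer cycles S-sol
    where
    -- the double edges v–h of G' force H into S
    H⊆S : v ∉ S → H ⊆ S
    H⊆S v∉S {h} h∈H with h ∈? S
    ... | yes h∈S = h∈S
    ... | no h∉S = ⊥-elim (S-sol i (v ∷ h ∷ [] , (v≢h , double) , v∉S ∷ h∉S ∷ []))
      where
      v≢h : v ≢ h
      v≢h v≡h = v∉Hv (H⊆Hv (subst (_∈ H) (sym v≡h) h∈H))
      double : 2 ≤ G' i v h
      double = ≤-reflexive (sym (reduce-double G i v H Q' h∈H))
    cycles : ∀ j c → IsCycle (G j) c → All (_∉ S) c → IsCycle (G' j) c
    cycles j c cyc avoid with v ∈? S
    ... | yes v∈S =
      cycle-mono (λ x∉S y∉S → reduce-≥ G i v H Q' ≤2 j (λ _ →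
        not-deleted-away-from-v (λ { refl → x∉S v∈S }) (λ { refl → y∉S v∈S }))) c cyc avoid
    ... | no v∉S =
      cycle-mono {Q = λ x → j ≡ i → ¬ InUnion Q' x}
        (λ x∉⋃ y∉⋃ → reduce-≥ G i v H Q' ≤2 j (λ j≡i → not-deleted-outside-Q' (x∉⋃ j≡i) (y∉⋃ j≡i))) c cyc
        (All.tabulate λ x∈c → λ { refl → All.lookup (cycle-misses-Q' Hv-fvs (H⊆S v∉S) v∉S cyc avoid) x∈c })

lemma9 : ∀ {α n : ℕ} (G : ColGraph α n) (k : ℕ) → 1 ≤ k
  → Symmetric G
  → (∀ (x : Fin n) → totalDeg G x ≢ 0)
  → (∀ (j : Fin α) (x : Fin n) → length (neighbours (G j) x) ≢ 1)
  → (∀ (x : Fin n) → ¬ (totalDeg G x ≡ 2 × length (neighboursG G x) ≡ 2))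
  → MultAtMost2 G
  → NoLoops G
  → (∀ (j : Fin α) (x : Fin n) → ¬ HasFlowerOfOrderAtLeast (G j) x (k + 1))
  → (i : Fin α) (v : Fin n) → 3 * k * (k + 4) < deg (G i) v
  → (Hv : Subset n) → v ∉ Hv → IsFVS (G i) Hv → ∣ Hv ∣ ≤ 3 * k
  → (H : Subset n) → H ⊆ Hv → Σ (Fin n) (λ h → h ∈ H)
  → (Q' : List (Subset n)) → Q' ≢ [] → Unique Q'
  → All (InCalD (G i) Hv v) Q'
  → Σ (List (Fin n × Subset n)) (IsExpansion (G i) (k + 2) H Q')
  → (∀ (D : Subset n) → D LMem.∈ Q' → ∀ (h : Fin n) → h ∈ Hv → BAdj (G i) h D → h ∈ H)
  → HasSimFVSOfSizeAtMost G k ⇔ HasSimFVSOfSizeAtMost (reduce G i v H Q') k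
lemma9 G k _ G-sym _ _ _ ≤2 _ _ i v _ Hv v∉Hv Hv-fvs _ H H⊆Hv _ Q' _ _ Q'⊆𝒟 expansion H-closed =
  mk⇔ (forward expansion) backward
  where open Directions G k G-sym ≤2 i v Hv v∉Hv Hv-fvs H H⊆Hv Q' Q'⊆𝒟 H-closed
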